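{- Let $m\ge1$ and $\beta$ be integers, and define $f(1)=2$ and $f(m)=(2m-2)\Gamma(2m-1)$ for $m\ge2$, where $\Gamma(\ell)$ is the least common multiple of $1,2,\dots,\ell$. Suppose $f(m)$ divides $\beta$. Then for any non-negative integers $x_0,x_1,\dots,x_{2m}$ with $\sum_{i=0}^{2m}ix_i=2m\beta$ and $\sum_{i=0}^{2m}x_i=2\beta$, there exist non-negative integers $x_{i,j}$ ($0\le i\le 2m$, $1\le j\le 2\beta/f(m)$) such that for each $1\le j\le 2\beta/f(m)$ we have $\sum_{i=0}^{2m}ix_{i,j}=mf(m)$ and $\sum_{i=0}^{2m}x_{i,j}=f(m)$, and for each $0\le i\le 2m$ we have $\sum_{j=1}^{2\beta/f(m)}x_{i,j}=x_i$. -}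

module Defs where

open import Data.Nat using (ℕ; zero; suc; _+_; _*_; _∸_)
open import Data.Nat.LCM using (lcm)
open import Data.Fin using (Fin; toℕ)

Γ : ℕ → ℕ
Γ zero    = 1
Γ (suc ℓ) = lcm (suc ℓ) (Γ ℓ)

-- f 1 = 2, f m = (2m-2) Γ(2m-1) for m ≥ 2  (value at 0 is irrelevant)
f : ℕ → ℕ
f zero          = 0
f (suc zero)    = 2
f (suc (suc k)) = (2 * suc (suc k) ∸ 2) * Γ (2 * suc (suc k) ∸ 1)

∑ : (n : ℕ) → (Fin n → ℕ) → ℕ
∑ zero    g = 0
∑ (suc n) g = g Fin.zero + ∑ n (λ i → g (Fin.suc i))

open import Data.Nat using (NonZero; ≢-nonZero; _≥_)
import Data.Nat.Base
open import Data.Nat.Properties using (m*n≢0; *-zeroʳ; m+1+n≢0)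
open import Data.Nat.LCM using (gcd*lcm)
open import Data.Nat.GCD using (gcd)
open import Relation.Binary.PropositionalEquality using (_≡_; refl; sym; trans; cong)

private
  Γ≢0 : ∀ ℓ → NonZero (Γ ℓ)
  Γ≢0 zero = _
  Γ≢0 (suc ℓ) = ≢-nonZero λ eq → absurd (trans (sym (gcd*lcm (suc ℓ) (Γ ℓ)))
                                          (trans (cong (gcd (suc ℓ) (Γ ℓ) *_) eq) (*-zeroʳ (gcd (suc ℓ) (Γ ℓ)))))
    where
      open import Data.Nat.Base using (≢-nonZero⁻¹)
      instance _ = Γ≢0 ℓ
      absurd : suc ℓ * Γ ℓ ≡ 0 → _
      absurd e = ≢-nonZero⁻¹ (suc ℓ * Γ ℓ) {{m*n≢0 (suc ℓ) (Γ ℓ)}} e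

f≢0 : ∀ m → m ≥ 1 → NonZero (f m)
f≢0 (suc zero) _ = _
f≢0 (suc (suc k)) _ = m*n≢0 (2 * suc (suc k) ∸ 2) (Γ (2 * suc (suc k) ∸ 1)) {{≢-nonZero (m+1+n≢0 k)}} {{Γ≢0 (2 * suc (suc k) ∸ 1)}}

-- Write the multiset as a list xs over Fin (2m+1) weighted by i ↦ i − m ∈ [−m, m]; the hypotheses say that
-- xs has total weight 0 and length k · f m with k = 2β / f m.  Let D = max(2, 2m − 1).  A non-empty
-- zero-sum list of such weights has a non-empty zero-sum sublist of length at most D: take a 0, or a pair
-- ±m, or the whole list if it is short; otherwise one of ±m is missing, the list can be ordered greedily
-- so that its prefix sums stay in a window of D integers, and two of the first D + 1 prefix sums agree.
-- Splitting off such blocks, blocks of equal length ℓ are packed Λ/ℓ at a time into zero-sum packs of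
-- length Λ = Γ(D), as every ℓ ≤ D divides Λ.  The rest has fewer than Λ/ℓ blocks of each length ℓ, so
-- it is a zero-sum list of length cΛ with c < D; together with D − 1 − c packs it forms one group, and
-- the other packs form groups of D − 1.  As f m = (D − 1) Γ(D), each group is a zero-sum list of length
-- f m, i.e. one column (x_{i,j})_i.

module Submission where

open import Defs

open import Algebra.Bundles using (CommutativeMonoid)
open import Data.Empty using (⊥-elim)
open import Data.Fin.Base using (Fin; zero; suc; toℕ; fromℕ<)
import Data.Fin.Properties as Fin
open import Data.Integer.Base using (ℤ; +_; -_; 0ℤ; 1ℤ; ∣_∣; +≤+; nonNegative)
  renaming (_+_ to _+ℤ_; _-_ to _-ℤ_; _*_ to _*ℤ_; _≤_ to _≤ℤ_; _<_ to _<ℤ_)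
open import Data.Integer.Divisibility using () renaming (_∣_ to _∣ℤ_)
import Data.Integer.Properties as ℤ
open import Data.Integer.Tactic.RingSolver using (solve-∀)
open import Algebra.Properties.AbelianGroup ℤ.+-0-abelianGroup using (∙-cancelˡ; ∙-cancelʳ)
open import Data.List.Base
  using (List; []; _∷_; _++_; length; map; foldr; take; drop; concat; tabulate; replicate)
import Data.List.Properties as List
open import Data.List.Relation.Binary.Permutation.Propositional as ↭
  using (_↭_; ↭-refl; ↭-reflexive; ↭-sym; ↭-trans; prep; swap; ↭⇒↭ₛ)
open import Data.List.Relation.Binary.Permutation.Propositional.Properties
  using (All-resp-↭; Any-resp-↭; map⁺; ↭-length; shift; shifts; ++⁺ˡ; ++⁺; ++-comm)
open import Data.List.Relation.Binary.Permutation.Setoid.Properties using (foldr-commMonoid)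
open import Data.List.Relation.Unary.All as All using (All; []; _∷_; search)
import Data.List.Relation.Unary.All.Properties as All
open import Data.List.Relation.Unary.Any using (Any; here; there)
open import Data.Nat.Base
  using (ℕ; zero; suc; z≤n; s≤s; _+_; _*_; _∸_; _⊓_; _≤_; _<_; _≥_; _/_; NonZero; ≢-nonZero⁻¹)
open import Data.Nat.Divisibility using (_∣_; divides; ∣-trans)
open import Data.Nat.DivMod using (m*n/n≡m)
open import Data.Nat.Induction using (<-wellFounded)
open import Data.Nat.LCM using (m∣lcm[m,n]; n∣lcm[m,n])
open import Data.Nat.ListAction using (sum)
open import Data.Nat.ListAction.Properties using (sum-++; sum-↭)
import Data.Nat.Properties as ℕ
import Data.Nat.Tactic.RingSolver as ℕ-Ring
open import Data.Product using (Σ; ∃₂; _×_; _,_; proj₁; proj₂)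
open import Data.Sum using (inj₁; inj₂)
open import Function using (_∘_)
open import Induction.WellFounded using (Acc; acc)
open import Relation.Binary.PropositionalEquality
  using (_≡_; _≢_; refl; sym; trans; cong; cong₂; subst; module ≡-Reasoning)
open import Relation.Nullary using (¬_; yes; no)
open import Relation.Unary using (Decidable)

Any-extract : ∀ {A : Set} {P : A → Set} {xs} → Any P xs → Σ A λ a → Σ (List A) λ ys → P a × xs ↭ a ∷ ys
Any-extract (here pa) = _ , _ , pa , ↭-refl
Any-extract {xs = x ∷ _} (there pxs) with a , ys , pa , xs↭ ← Any-extract pxs =
  a , x ∷ ys , pa , ↭-trans (prep x xs↭) (swap x a ↭-refl)

split-by : ∀ {A : Set} {P : A → Set} → Decidable P → ∀ xs →
           Σ (List A) λ ys → Σ (List A) λ zs → xs ↭ ys ++ zs × All P ys × All (¬_ ∘ P) zs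
split-by P? [] = [] , [] , ↭-refl , [] , []
split-by P? (x ∷ xs) with split-by P? xs | P? x
... | ys , zs , xs↭ , Pys , ¬Pzs | yes Px = x ∷ ys , zs , prep x xs↭ , Px ∷ Pys , ¬Pzs
... | ys , zs , xs↭ , Pys , ¬Pzs | no ¬Px =
  ys , x ∷ zs , ↭-trans (prep x xs↭) (↭-sym (shift x ys zs)) , Pys , ¬Px ∷ ¬Pzs

length-complement< : ∀ {A : Set} {xs ys zs : List A} → xs ↭ ys ++ zs → 1 ≤ length ys → length zs < length xs
length-complement< {ys = ys} {zs} xs↭ 1≤|ys| =
  ℕ.≤-trans (ℕ.+-monoˡ-≤ (length zs) 1≤|ys|) (ℕ.≤-reflexive (sym (trans (↭-length xs↭) (List.length-++ ys))))

++-interchange : ∀ {A : Set} (as bs cs ds : List A) → (as ++ bs) ++ (cs ++ ds) ↭ (as ++ cs) ++ (bs ++ ds)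
++-interchange as bs cs ds = begin
  (as ++ bs) ++ (cs ++ ds)  ≡⟨ List.++-assoc as bs (cs ++ ds) ⟩
  as ++ bs ++ cs ++ ds      ↭⟨ ++⁺ˡ as (shifts bs cs) ⟩
  as ++ cs ++ bs ++ ds      ≡⟨ List.++-assoc as cs (bs ++ ds) ⟨
  (as ++ cs) ++ (bs ++ ds)  ∎
  where open ↭.PermutationReasoning

concat-↭ : ∀ {A : Set} {xss yss : List (List A)} → xss ↭ yss → concat xss ↭ concat yss
concat-↭ ↭.refl         = ↭-refl
concat-↭ (prep xs p)    = ++⁺ˡ xs (concat-↭ p)
concat-↭ (swap xs ys p) = ↭-trans (++⁺ˡ xs (++⁺ˡ ys (concat-↭ p))) (shifts xs ys)
concat-↭ (↭.trans p q)  = ↭-trans (concat-↭ p) (concat-↭ q)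

concat-↭-merge : ∀ {A : Set} {Bs Cs Ds Ps Qs : List (List A)} {xs ys} → Bs ↭ Cs ++ Ds →
                 concat Cs ↭ concat Ps ++ xs → concat Ds ↭ concat Qs ++ ys →
                 concat Bs ↭ concat (Ps ++ Qs) ++ (xs ++ ys)
concat-↭-merge {Bs = Bs} {Cs} {Ds} {Ps} {Qs} {xs} {ys} Bs↭ Cs↭ Ds↭ = begin
  concat Bs                            ↭⟨ concat-↭ Bs↭ ⟩
  concat (Cs ++ Ds)                    ≡⟨ List.concat-++ Cs Ds ⟨
  concat Cs ++ concat Ds               ↭⟨ ++⁺ Cs↭ Ds↭ ⟩
  (concat Ps ++ xs) ++ (concat Qs ++ ys) ↭⟨ ++-interchange (concat Ps) xs (concat Qs) ys ⟩
  (concat Ps ++ concat Qs) ++ (xs ++ ys) ≡⟨ cong (_++ (xs ++ ys)) (List.concat-++ Ps Qs) ⟩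
  concat (Ps ++ Qs) ++ (xs ++ ys)      ∎
  where open ↭.PermutationReasoning

concat-take-drop : ∀ {A : Set} n (xss : List (List A)) → concat xss ≡ concat (take n xss) ++ concat (drop n xss)
concat-take-drop n xss =
  trans (cong concat (sym (List.take++drop≡id n xss))) (sym (List.concat-++ (take n xss) (drop n xss)))

length-concat-uniform : ∀ {A : Set} {ℓ} {xss : List (List A)} → All (λ xs → length xs ≡ ℓ) xss →
                        length (concat xss) ≡ length xss * ℓ
length-concat-uniform []                          = refl
length-concat-uniform {xss = xs ∷ _} (|xs| ∷ ps) =
  trans (List.length-++ xs) (cong₂ _+_ |xs| (length-concat-uniform ps))

module _ {A : Set} (w : A → ℤ) where

  weight : List A → ℤ
  weight xs = foldr _+ℤ_ 0ℤ (map w xs)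

  weight-++ : ∀ xs ys → weight (xs ++ ys) ≡ weight xs +ℤ weight ys
  weight-++ []       ys = sym (ℤ.+-identityˡ _)
  weight-++ (x ∷ xs) ys = trans (cong (w x +ℤ_) (weight-++ xs ys)) (sym (ℤ.+-assoc (w x) _ _))

  weight-↭ : ∀ {xs ys} → xs ↭ ys → weight xs ≡ weight ys
  weight-↭ p = foldr-commMonoid ℤ+.setoid ℤ+.isCommutativeMonoid (↭⇒↭ₛ (map⁺ w p))
    where module ℤ+ = CommutativeMonoid ℤ.+-0-commutativeMonoid

  weight-concat : ∀ {xss} → All (λ xs → weight xs ≡ 0ℤ) xss → weight (concat xss) ≡ 0ℤ
  weight-concat []                       = refl
  weight-concat {xs ∷ _} (xs≡0 ∷ xss≡0) = trans (weight-++ xs _) (cong₂ _+ℤ_ xs≡0 (weight-concat xss≡0))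

  weight-complement : ∀ {xs ys zs} → xs ↭ ys ++ zs → weight xs ≡ 0ℤ → weight ys ≡ 0ℤ → weight zs ≡ 0ℤ
  weight-complement {xs} {ys} {zs} xs↭ xs≡0 ys≡0 = begin
    weight zs                ≡⟨ ℤ.+-identityˡ (weight zs) ⟨
    0ℤ +ℤ weight zs          ≡⟨ cong (_+ℤ weight zs) ys≡0 ⟨
    weight ys +ℤ weight zs   ≡⟨ weight-++ ys zs ⟨
    weight (ys ++ zs)        ≡⟨ weight-↭ xs↭ ⟨
    weight xs                ≡⟨ xs≡0 ⟩
    0ℤ                       ∎
    where open ≡-Reasoning

  weight-nonneg : ∀ {xs} → All (λ a → 0ℤ ≤ℤ w a) xs → 0ℤ ≤ℤ weight xs
  weight-nonneg []       = ℤ.≤-refl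
  weight-nonneg (p ∷ ps) = ℤ.+-mono-≤ p (weight-nonneg ps)

  weight-nonpos : ∀ {xs} → All (λ a → w a ≤ℤ 0ℤ) xs → weight xs ≤ℤ 0ℤ
  weight-nonpos []       = ℤ.≤-refl
  weight-nonpos (p ∷ ps) = ℤ.+-mono-≤ p (weight-nonpos ps)

  positive-summand : ∀ {x xs} → All (λ a → w a ≢ 0ℤ) (x ∷ xs) → 0ℤ ≤ℤ weight (x ∷ xs) →
                     Any (λ a → 0ℤ <ℤ w a) (x ∷ xs)
  positive-summand {x} {xs} (wx≢0 ∷ _) 0≤Σ with search (λ a → 0ℤ ℤ.<? w a) (x ∷ xs)
  ... | inj₂ pos           = pos
  ... | inj₁ (wx≯0 ∷ ws≯0) = ⊥-elim (ℤ.<⇒≱ Σ<0 0≤Σ)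
    where
    Σ<0 : weight (x ∷ xs) <ℤ 0ℤ
    Σ<0 = ℤ.+-mono-<-≤ (ℤ.≤∧≢⇒< (ℤ.≮⇒≥ wx≯0) wx≢0) (weight-nonpos (All.map ℤ.≮⇒≥ ws≯0))

  negative-summand : ∀ {xs} → weight xs <ℤ 0ℤ → Any (λ a → w a <ℤ 0ℤ) xs
  negative-summand {xs} Σ<0 with search (λ a → w a ℤ.<? 0ℤ) xs
  ... | inj₂ neg  = neg
  ... | inj₁ ws≮0 = ⊥-elim (ℤ.<⇒≱ Σ<0 (weight-nonneg (All.map ℤ.≮⇒≥ ws≮0)))

weight-neg : ∀ {A : Set} (w : A → ℤ) xs → weight (-_ ∘ w) xs ≡ - weight w xs
weight-neg w []       = refl
weight-neg w (x ∷ xs) = trans (cong (- w x +ℤ_) (weight-neg w xs)) (sym (ℤ.neg-distrib-+ (w x) (weight w xs)))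

Window : ℕ → ℕ → ℤ → Set
Window e p s = - (+ e) ≤ℤ s × s ≤ℤ + p

window-step-up : ∀ {e p s v} → Window e p s → s ≤ℤ 0ℤ → 0ℤ <ℤ v → v ≤ℤ + p → Window e p (s +ℤ v)
window-step-up {s = s} {v} (-e≤s , _) s≤0 0<v v≤p =
  ℤ.≤-trans -e≤s (ℤ.i≤i+j s v {{nonNegative (ℤ.<⇒≤ 0<v)}}) ,
  ℤ.≤-trans (ℤ.+-monoˡ-≤ v s≤0) (ℤ.≤-trans (ℤ.≤-reflexive (ℤ.+-identityˡ v)) v≤p)

window-step-down : ∀ {e p s v} → Window e p s → 0ℤ <ℤ s → - (+ suc e) ≤ℤ v → v <ℤ 0ℤ → Window e p (s +ℤ v)
window-step-down {e} {s = s} {v} (_ , s≤p) 0<s -1-e≤v v<0 =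
  ℤ.≤-trans (ℤ.≤-reflexive (one-less (+ e))) (ℤ.+-mono-≤ (ℤ.i<j⇒suc[i]≤j 0<s) -1-e≤v) ,
  ℤ.≤-trans (ℤ.+-monoʳ-≤ s (ℤ.<⇒≤ v<0)) (ℤ.≤-trans (ℤ.≤-reflexive (ℤ.+-identityʳ s)) s≤p)
  where
  one-less : ∀ x → - x ≡ 1ℤ +ℤ - (1ℤ +ℤ x)
  one-less = solve-∀

window-neg : ∀ {m v} → Window m m v → Window m m (- v)
window-neg {m} {v} (-m≤v , v≤m) = ℤ.neg-mono-≤ v≤m , subst (- v ≤ℤ_) (ℤ.neg-involutive (+ m)) (ℤ.neg-mono-≤ -m≤v)

window-offset-nonneg : ∀ {e p s} → Window e p s → 0ℤ ≤ℤ s +ℤ + e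
window-offset-nonneg {e} (-e≤s , _) =
  ℤ.≤-trans (ℤ.≤-reflexive (sym (ℤ.+-inverseˡ (+ e)))) (ℤ.+-monoˡ-≤ (+ e) -e≤s)

window-index : ∀ {e p s} → Window e p s → Fin (suc (e + p))
window-index {e} {p} {s} win@(_ , s≤p) = fromℕ< (s≤s (ℤ.drop‿+≤+ (begin
  + ∣ s +ℤ + e ∣  ≡⟨ ℤ.0≤i⇒+∣i∣≡i (window-offset-nonneg win) ⟩
  s +ℤ + e        ≤⟨ ℤ.+-monoˡ-≤ (+ e) s≤p ⟩
  + p +ℤ + e      ≡⟨ ℤ.+-comm (+ p) (+ e) ⟩
  + (e + p)       ∎)))
  where open ℤ.≤-Reasoning

window-index-injective : ∀ {e p s t} (ws : Window e p s) (wt : Window e p t) →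
                         window-index ws ≡ window-index wt → s ≡ t
window-index-injective {e} {s = s} {t} ws wt same = ∙-cancelʳ (+ e) s t (begin
  s +ℤ + e        ≡⟨ ℤ.0≤i⇒+∣i∣≡i (window-offset-nonneg ws) ⟨
  + ∣ s +ℤ + e ∣  ≡⟨ cong +_ (trans (sym (Fin.toℕ-fromℕ< _)) (trans (cong toℕ same) (Fin.toℕ-fromℕ< _))) ⟩
  + ∣ t +ℤ + e ∣  ≡⟨ ℤ.0≤i⇒+∣i∣≡i (window-offset-nonneg wt) ⟩
  t +ℤ + e        ∎)
  where open ≡-Reasoning

window-pigeonhole : ∀ {e p} (g : ℕ → ℤ) → (∀ i → Window e p (g i)) →
                    ∃₂ λ i j → i < j × j ≤ suc (e + p) × g i ≡ g j
window-pigeonhole {e} {p} g win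
  with i , j , i<j , same ← Fin.pigeonhole (ℕ.n<1+n (suc (e + p))) (λ i → window-index (win (toℕ i)))
  = toℕ i , toℕ j , i<j , ℕ.≤-pred (Fin.toℕ<n j) , window-index-injective (win _) (win _) same

module _ {A : Set} (w : A → ℤ) where

  PrefixSumsIn : (ℤ → Set) → ℤ → List A → Set
  PrefixSumsIn P s xs = ∀ i → P (s +ℤ weight w (take i xs))

  prefixSums-[] : ∀ {P s} → P s → PrefixSumsIn P s []
  prefixSums-[] {P} {s} Ps zero    = subst P (sym (ℤ.+-identityʳ s)) Ps
  prefixSums-[] {P} {s} Ps (suc i) = subst P (sym (ℤ.+-identityʳ s)) Ps

  prefixSums-∷ : ∀ {P s x xs} → P s → PrefixSumsIn P (s +ℤ w x) xs → PrefixSumsIn P s (x ∷ xs)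
  prefixSums-∷ {P} {s}     Ps _   zero    = subst P (sym (ℤ.+-identityʳ s)) Ps
  prefixSums-∷ {P} {s} {x} _  Pxs (suc i) = subst P (ℤ.+-assoc s (w x) _) (Pxs i)

  weight-after : ∀ {s x xs a ys} → x ∷ xs ↭ a ∷ ys → weight w (x ∷ xs) ≡ - s → weight w ys ≡ - (s +ℤ w a)
  weight-after {s} {a = a} {ys} perm Σ≡-s = begin
    weight w ys                    ≡⟨ rearrange (w a) (weight w ys) ⟩
    - w a +ℤ (w a +ℤ weight w ys)  ≡⟨ cong (- w a +ℤ_) (trans (sym (weight-↭ w perm)) Σ≡-s) ⟩
    - w a +ℤ - s                   ≡⟨ ℤ.+-comm (- w a) (- s) ⟩
    - s +ℤ - w a                   ≡⟨ ℤ.neg-distrib-+ s (w a) ⟨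
    - (s +ℤ w a)                   ∎
    where
    open ≡-Reasoning
    rearrange : ∀ u v → v ≡ - u +ℤ (u +ℤ v)
    rearrange = solve-∀

  Admissible : ℕ → ℕ → A → Set
  Admissible e p a = w a ≢ 0ℤ × Window (suc e) p (w a)

  -- The greedy order: a positive summand while the running total s is ≤ 0, a negative one otherwise.
  -- The remaining summands add up to −s, so the required summand exists.
  next-summand : ∀ {e p s x xs} → All (Admissible e p) (x ∷ xs) → Window e p s → weight w (x ∷ xs) ≡ - s →
                 Σ A λ a → Σ (List A) λ ys → (x ∷ xs ↭ a ∷ ys) × Window e p (s +ℤ w a)
  next-summand {s = s} adm win Σ≡-s with s ℤ.≤? 0ℤ
  ... | yes s≤0
    with a , ys , 0<a , perm ← Any-extract (positive-summand w (All.map proj₁ adm)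
                                              (subst (0ℤ ≤ℤ_) (sym Σ≡-s) (ℤ.neg-mono-≤ s≤0)))
    = a , ys , perm , window-step-up win s≤0 0<a (proj₂ (proj₂ (All.head (All-resp-↭ perm adm))))
  ... | no s≰0
    with a , ys , a<0 , perm ← Any-extract (negative-summand w (subst (_<ℤ 0ℤ) (sym Σ≡-s)
                                                                     (ℤ.neg-mono-< (ℤ.≰⇒> s≰0))))
    = a , ys , perm , window-step-down win (ℤ.≰⇒> s≰0) (proj₁ (proj₂ (All.head (All-resp-↭ perm adm)))) a<0

  balanced-ordering : ∀ {e p s} xs → All (Admissible e p) xs → Window e p s → weight w xs ≡ - s →
                      Acc _<_ (length xs) → Σ (List A) λ ys → xs ↭ ys × PrefixSumsIn (Window e p) s ys
  balanced-ordering {e} {p} []       _   win _    _             = [] , ↭-refl , prefixSums-[] {Window e p} win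
  balanced-ordering {e} {p} (x ∷ xs) adm win Σ≡-s (acc shorter)
    with a , ys , perm , win′ ← next-summand adm win Σ≡-s
    with zs , ys↭zs , sums ← balanced-ordering ys (All.tail (All-resp-↭ perm adm)) win′ (weight-after perm Σ≡-s)
                                                (shorter (ℕ.≤-reflexive (sym (↭-length perm))))
    = a ∷ zs , ↭-trans perm (prep a ys↭zs) , prefixSums-∷ {Window e p} win sums

  zero-sum-infix : ∀ {i j} xs → i ≤ j → j ≤ length xs → weight w (take i xs) ≡ weight w (take j xs) →
                   Σ (List A) λ H → Σ (List A) λ R → xs ↭ H ++ R × weight w H ≡ 0ℤ × length H ≡ j ∸ i
  zero-sum-infix {i} {j} xs i≤j j≤n same = H , take i xs ++ drop j xs , xs↭ , weight-H , length-H
    where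
    open ≡-Reasoning
    H = drop i (take j xs)
    take-j : take j xs ≡ take i xs ++ H
    take-j = begin
      take j xs                ≡⟨ List.take++drop≡id i (take j xs) ⟨
      take i (take j xs) ++ H  ≡⟨ cong (_++ H) (List.take-take i j xs) ⟩
      take (i ⊓ j) xs ++ H     ≡⟨ cong (λ k → take k xs ++ H) (ℕ.m≤n⇒m⊓n≡m i≤j) ⟩
      take i xs ++ H           ∎
    xs↭ : xs ↭ H ++ (take i xs ++ drop j xs)
    xs↭ = ↭-trans (↭-reflexive (begin
      xs                             ≡⟨ List.take++drop≡id j xs ⟨
      take j xs ++ drop j xs         ≡⟨ cong (_++ drop j xs) take-j ⟩
      (take i xs ++ H) ++ drop j xs  ≡⟨ List.++-assoc (take i xs) H (drop j xs) ⟩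
      take i xs ++ H ++ drop j xs    ∎)) (shifts (take i xs) H)
    weight-H : weight w H ≡ 0ℤ
    weight-H = ∙-cancelˡ (weight w (take i xs)) (weight w H) 0ℤ (begin
      weight w (take i xs) +ℤ weight w H  ≡⟨ weight-++ w (take i xs) H ⟨
      weight w (take i xs ++ H)           ≡⟨ cong (weight w) take-j ⟨
      weight w (take j xs)                ≡⟨ same ⟨
      weight w (take i xs)                ≡⟨ ℤ.+-identityʳ _ ⟨
      weight w (take i xs) +ℤ 0ℤ          ∎)
    length-H : length H ≡ j ∸ i
    length-H = trans (List.length-drop i (take j xs))
                     (cong (_∸ i) (trans (List.length-take j xs) (ℕ.m≤n⇒m⊓n≡m j≤n)))

  ZeroSumBlock : ℕ → List A → Set
  ZeroSumBlock d B = weight w B ≡ 0ℤ × 1 ≤ length B × length B ≤ d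

  BlockSplit : ℕ → List A → Set
  BlockSplit d xs = Σ (List A) λ H → Σ (List A) λ R → xs ↭ H ++ R × ZeroSumBlock d H

  block-split-admissible : ∀ e p xs → All (Admissible e p) xs → weight w xs ≡ 0ℤ → suc (e + p) ≤ length xs →
                           BlockSplit (suc (e + p)) xs
  block-split-admissible e p xs adm Σ≡0 long
    with ys , xs↭ys , sums ← balanced-ordering xs adm (ℤ.neg-mono-≤ (+≤+ z≤n) , +≤+ z≤n) Σ≡0 (<-wellFounded _)
    = let i , j , i<j , j≤D , same = window-pigeonhole (λ i → weight w (take i ys))
                                       (λ i → subst (Window e p) (ℤ.+-identityˡ _) (sums i))
          H , R , ys↭ , H≡0 , |H| = zero-sum-infix ys (ℕ.<⇒≤ i<j)
                                      (ℕ.≤-trans j≤D (subst (_ ≤_) (↭-length xs↭ys) long)) same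
      in H , R , ↭-trans xs↭ys ys↭ , H≡0 ,
         subst (1 ≤_) (sym |H|) (ℕ.m<n⇒0<n∸m i<j) , ℕ.≤-trans (ℕ.≤-reflexive |H|) (ℕ.≤-trans (ℕ.m∸n≤m j i) j≤D)

+m≢-m : ∀ {m} → 1 ≤ m → + m ≢ - (+ m)
+m≢-m (s≤s _) ()

above-minimum : ∀ {e m v} → m ≤ 2 + e → - (+ m) ≤ℤ v → v ≢ - (+ m) → - (+ suc e) ≤ℤ v
above-minimum m≤2+e -m≤v v≢-m =
  ℤ.≤-trans (ℤ.+-monoʳ-≤ 1ℤ (ℤ.neg-mono-≤ (+≤+ m≤2+e))) (ℤ.i<j⇒suc[i]≤j (ℤ.≤∧≢⇒< -m≤v (v≢-m ∘ sym)))

nonzero-above-minimum : ∀ {e m v} → m ≤ 2 + e → Window m m v → v ≢ 0ℤ → v ≢ - (+ m) →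
                        v ≢ 0ℤ × Window (suc e) m v
nonzero-above-minimum m≤2+e (-m≤v , v≤m) v≢0 v≢-m = v≢0 , above-minimum m≤2+e -m≤v v≢-m , v≤m

nonzero-below-maximum : ∀ {e m v} → m ≤ 2 + e → Window m m v → v ≢ 0ℤ → v ≢ + m →
                        - v ≢ 0ℤ × Window (suc e) m (- v)
nonzero-below-maximum m≤2+e win v≢0 v≢m =
  nonzero-above-minimum m≤2+e (window-neg win) (v≢0 ∘ ℤ.neg-injective) (v≢m ∘ ℤ.neg-injective)

module _ {A : Set} (w : A → ℤ) where

  zeroSumBlock-neg : ∀ {d B} → ZeroSumBlock (-_ ∘ w) d B → ZeroSumBlock w d B
  zeroSumBlock-neg {B = B} (Σ≡0 , bounds) =
    trans (sym (ℤ.neg-involutive (weight w B))) (cong -_ (trans (sym (weight-neg w B)) Σ≡0)) , bounds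

  block-split-zero : ∀ {d xs} → 1 ≤ d → Any (λ a → w a ≡ 0ℤ) xs → BlockSplit w d xs
  block-split-zero 1≤d has-zero =
    let a , ys , wa≡0 , xs↭ = Any-extract has-zero
    in a ∷ [] , ys , xs↭ , trans (ℤ.+-identityʳ (w a)) wa≡0 , s≤s z≤n , 1≤d

  block-split-pair : ∀ {m d xs} → 1 ≤ m → 2 ≤ d → Any (λ a → w a ≡ - (+ m)) xs → Any (λ a → w a ≡ + m) xs →
                     BlockSplit w d xs
  block-split-pair {m} 1≤m 2≤d has-min has-max with a , ys , wa≡m , xs↭ays ← Any-extract has-max
    with Any-resp-↭ xs↭ays has-min
  ... | here wa≡-m = ⊥-elim (+m≢-m 1≤m (trans (sym wa≡m) wa≡-m))
  ... | there has-min′ =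
    let b , zs , wb≡-m , ys↭ = Any-extract has-min′
    in a ∷ b ∷ [] , zs , ↭-trans xs↭ays (prep a ys↭) ,
       trans (cong₂ (λ u v → u +ℤ (v +ℤ 0ℤ)) wa≡m wb≡-m)
             (trans (cong (+ m +ℤ_) (ℤ.+-identityʳ (- (+ m)))) (ℤ.+-inverseʳ (+ m))) ,
       s≤s z≤n , 2≤d

  -- Without −m (resp. +m) the non-zero weights (resp. their negatives) lie in [−(m − 1), m], and
  -- m − 1 ≤ 1 + e makes them admissible for a window of 1 + e + m values.
  block-split-bounded : ∀ e m → 1 ≤ m → m ≤ 2 + e → ∀ xs → All (Window m m ∘ w) xs → weight w xs ≡ 0ℤ →
                        1 ≤ length xs → BlockSplit w (suc (e + m)) xs
  block-split-bounded e m 1≤m m≤2+e xs bounded Σ≡0 nonempty with search (λ a → w a ℤ.≟ 0ℤ) xs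
  ... | inj₂ has-zero = block-split-zero (s≤s z≤n) has-zero
  ... | inj₁ nonzero with length xs ℕ.≤? suc (e + m)
  ...   | yes short = xs , [] , ↭-reflexive (sym (List.++-identityʳ xs)) , Σ≡0 , nonempty , short
  ...   | no long with search (λ a → w a ℤ.≟ - (+ m)) xs | search (λ a → w a ℤ.≟ + m) xs
  ...     | inj₁ no-min | _ =
    block-split-admissible w e m xs
      (All.zipWith (λ (win , wa≢0 , wa≢-m) → nonzero-above-minimum m≤2+e win wa≢0 wa≢-m)
                   (bounded , All.zip (nonzero , no-min)))
      Σ≡0 (ℕ.≰⇒≥ long)
  ...     | inj₂ _ | inj₁ no-max =
    let H , R , xs↭ , block = block-split-admissible (-_ ∘ w) e m xs
                                (All.zipWith (λ (win , wa≢0 , wa≢m) → nonzero-below-maximum m≤2+e win wa≢0 wa≢m)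
                                             (bounded , All.zip (nonzero , no-max)))
                                (trans (weight-neg w xs) (cong -_ Σ≡0)) (ℕ.≰⇒≥ long)
    in H , R , xs↭ , zeroSumBlock-neg {suc (e + m)} {H} block
  ...     | inj₂ has-min | inj₂ has-max =
    block-split-pair 1≤m (s≤s (ℕ.≤-trans 1≤m (ℕ.m≤n+m m e))) has-min has-max

  decompose-into-blocks : ∀ e m → 1 ≤ m → m ≤ 2 + e → ∀ xs → All (Window m m ∘ w) xs → weight w xs ≡ 0ℤ →
                          Acc _<_ (length xs) →
                          Σ (List (List A)) λ Bs → xs ↭ concat Bs × All (ZeroSumBlock w (suc (e + m))) Bs
  decompose-into-blocks e m 1≤m m≤2+e [] _ _ _ = [] , ↭-refl , []
  decompose-into-blocks e m 1≤m m≤2+e xs@(_ ∷ _) bounded Σ≡0 (acc shorter) =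
    let H , R , xs↭ , block@(H≡0 , 1≤|H| , _) = block-split-bounded e m 1≤m m≤2+e xs bounded Σ≡0 (s≤s z≤n)
        Bs , R↭ , blocks = decompose-into-blocks e m 1≤m m≤2+e R (All.++⁻ʳ H (All-resp-↭ xs↭ bounded))
                             (weight-complement w {xs} {H} {R} xs↭ Σ≡0 H≡0)
                             (shorter (length-complement< {ys = H} {R} xs↭ 1≤|H|))
    in H ∷ Bs , ↭-trans xs↭ (++⁺ˡ H R↭) , block ∷ blocks

module _ {A : Set} (w : A → ℤ) where

  ZeroSumOfLength : ℕ → List A → Set
  ZeroSumOfLength n B = weight w B ≡ 0ℤ × length B ≡ n

  concat-zeroSumOfLength : ∀ {ℓ Bs} → All (ZeroSumOfLength ℓ) Bs → ZeroSumOfLength (length Bs * ℓ) (concat Bs)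
  concat-zeroSumOfLength blocks = weight-concat w (All.map proj₁ blocks) , length-concat-uniform (All.map proj₂ blocks)

  pack-uniform-blocks : ∀ {ℓ Λ} q .{{_ : NonZero ℓ}} → 1 ≤ q → q * ℓ ≡ Λ →
                        ∀ Cs → All (ZeroSumOfLength ℓ) Cs → Acc _<_ (length Cs) →
                        Σ (List (List A)) λ Ps → Σ (List A) λ Lo →
                          concat Cs ↭ concat Ps ++ Lo × All (ZeroSumOfLength Λ) Ps × weight w Lo ≡ 0ℤ × length Lo < Λ
  pack-uniform-blocks {ℓ} q 1≤q q*ℓ≡Λ Cs blocks (acc shorter) with q ℕ.≤? length Cs
  ... | no few =
    let Cs≡0 , |Cs| = concat-zeroSumOfLength blocks
    in [] , concat Cs , ↭-refl , [] , Cs≡0 ,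
       subst (_< _) (sym |Cs|) (ℕ.<-≤-trans (ℕ.*-monoˡ-< ℓ (ℕ.≰⇒> few)) (ℕ.≤-reflexive q*ℓ≡Λ))
  ... | yes enough =
    let P = concat (take q Cs)
        P≡0 , |P| = concat-zeroSumOfLength (All.take⁺ q blocks)
        Ps , Lo , rest↭ , packs , Lo≡0 , |Lo|<Λ =
          pack-uniform-blocks q 1≤q q*ℓ≡Λ (drop q Cs) (All.drop⁺ q blocks)
            (shorter (subst (_< length Cs) (sym (List.length-drop q Cs)) (ℕ.∸-monoʳ-< 1≤q enough)))
    in P ∷ Ps , Lo ,
       ↭-trans (↭-reflexive (concat-take-drop q Cs))
               (↭-trans (++⁺ˡ P rest↭) (↭-reflexive (sym (List.++-assoc P (concat Ps) Lo)))) ,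
       (P≡0 , trans |P| (trans (cong (_* ℓ) (trans (List.length-take q Cs) (ℕ.m≤n⇒m⊓n≡m enough))) q*ℓ≡Λ)) ∷ packs ,
       Lo≡0 , |Lo|<Λ

  pack-blocks : ∀ {Λ} d .{{_ : NonZero Λ}} → (∀ ℓ → 1 ≤ ℓ → ℓ ≤ d → ℓ ∣ Λ) →
                ∀ Bs → All (ZeroSumBlock w d) Bs →
                Σ (List (List A)) λ Ps → Σ (List A) λ Lo →
                  concat Bs ↭ concat Ps ++ Lo × All (ZeroSumOfLength Λ) Ps × weight w Lo ≡ 0ℤ × length Lo + d ≤ d * Λ
  pack-blocks zero _ []      []                        = [] , [] , ↭-refl , [] , refl , z≤n
  pack-blocks zero _ (_ ∷ _) ((_ , 1≤|B| , |B|≤0) ∷ _) = ⊥-elim (ℕ.<⇒≱ 1≤|B| |B|≤0)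
  pack-blocks {Λ} (suc d) divisors Bs blocks =
    let Cs , Ds , Bs↭ , exact , inexact = split-by (λ B → length B ℕ.≟ suc d) Bs
        blocks′ = All-resp-↭ Bs↭ blocks
        divides q Λ≡q*ℓ = divisors (suc d) (s≤s z≤n) ℕ.≤-refl
        Ps , Lo₁ , Cs↭ , packs₁ , Lo₁≡0 , |Lo₁|<Λ =
          pack-uniform-blocks q (quotient-positive Λ≡q*ℓ) (sym Λ≡q*ℓ) Cs
            (All.zipWith (λ ((B≡0 , _) , |B|≡) → B≡0 , |B|≡) (All.++⁻ˡ Cs blocks′ , exact)) (<-wellFounded _)
        Qs , Lo₂ , Ds↭ , packs₂ , Lo₂≡0 , |Lo₂|+d≤d*Λ =
          pack-blocks d (λ ℓ 1≤ℓ ℓ≤d → divisors ℓ 1≤ℓ (ℕ.m≤n⇒m≤1+n ℓ≤d)) Ds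
            (All.zipWith (λ ((B≡0 , 1≤|B| , |B|≤) , |B|≢) → B≡0 , 1≤|B| , ℕ.≤-pred (ℕ.≤∧≢⇒< |B|≤ |B|≢))
                         (All.++⁻ʳ Cs blocks′ , inexact))
    in Ps ++ Qs , Lo₁ ++ Lo₂ , concat-↭-merge {Cs = Cs} {Ds} {Ps} {Qs} Bs↭ Cs↭ Ds↭ , All.++⁺ packs₁ packs₂ ,
       trans (weight-++ w Lo₁ Lo₂) (cong₂ _+ℤ_ Lo₁≡0 Lo₂≡0) ,
       ℕ.≤-trans (ℕ.≤-reflexive (regroup {length Lo₁} {length Lo₂} (List.length-++ Lo₁))) (ℕ.+-mono-≤ |Lo₁|<Λ |Lo₂|+d≤d*Λ)
    where
    quotient-positive : ∀ {q ℓ} → Λ ≡ q * ℓ → 1 ≤ q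
    quotient-positive {zero}  Λ≡0 = ⊥-elim (≢-nonZero⁻¹ Λ Λ≡0)
    quotient-positive {suc _} _   = s≤s z≤n
    regroup : ∀ {l₁ l₂ l} → l ≡ l₁ + l₂ → l + suc d ≡ suc l₁ + (l₂ + d)
    regroup {l₁} {l₂} refl = +-regroup l₁ l₂ d
      where
      +-regroup : ∀ a b c → a + b + suc c ≡ suc a + (b + c)
      +-regroup = ℕ-Ring.solve-∀

  -- The first group is the leftover Lo (c units of Λ) topped up with r ∸ c packs.
  assemble-groups : ∀ {Λ r} k c Lo Ps → c ≤ r → weight w Lo ≡ 0ℤ → length Lo ≡ c * Λ →
                    All (ZeroSumOfLength Λ) Ps → c + length Ps ≡ k * r →
                    Σ (Fin k → List A) λ G → Lo ++ concat Ps ≡ concat (tabulate G) ×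
                                             (∀ j → ZeroSumOfLength (r * Λ) (G j))
  assemble-groups zero    zero    []      []      _ _ _  _ _  = (λ ()) , refl , λ ()
  assemble-groups zero    zero    (_ ∷ _) _       _ _ () _ _
  assemble-groups zero    zero    []      (_ ∷ _) _ _ _  _ ()
  assemble-groups zero    (suc c) _       _       _ _ _  _ ()
  assemble-groups {Λ} {r} (suc k) c Lo Ps c≤r Lo≡0 |Lo| packs count =
    let t = r ∸ c
        top≡0 , |top| = concat-zeroSumOfLength (All.take⁺ t packs)
        G , rest≡ , groups = assemble-groups k 0 [] (drop t Ps) z≤n refl refl (All.drop⁺ t packs)
                               (trans (List.length-drop t Ps) (trans (cong (_∸ t) |Ps|) (ℕ.m+n∸m≡n t (k * r))))
    in (λ { zero → Lo ++ concat (take t Ps) ; (suc j) → G j }) ,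
       trans (cong (Lo ++_) (concat-take-drop t Ps))
             (trans (sym (List.++-assoc Lo _ _)) (cong ((Lo ++ concat (take t Ps)) ++_) rest≡)) ,
       λ { zero → trans (weight-++ w Lo _) (cong₂ _+ℤ_ Lo≡0 top≡0) ,
                  trans (List.length-++ Lo) (trans (cong₂ _+_ |Lo| (trans |top| (cong (_* Λ) |take|)))
                        (trans (sym (ℕ.*-distribʳ-+ Λ c t)) (cong (_* Λ) (ℕ.m+[n∸m]≡n c≤r))))
         ; (suc j) → groups j }
    where
    |Ps| : length Ps ≡ r ∸ c + k * r
    |Ps| = trans (sym (ℕ.m+n∸m≡n c (length Ps))) (trans (cong (_∸ c) count) (ℕ.+-∸-comm (k * r) c≤r))
    |take| : length (take (r ∸ c) Ps) ≡ r ∸ c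
    |take| = trans (List.length-take (r ∸ c) Ps)
                   (ℕ.m≤n⇒m⊓n≡m (subst (r ∸ c ≤_) (sym |Ps|) (ℕ.m≤m+n (r ∸ c) (k * r))))

leftover-units : ∀ {P L K Λ r} .{{_ : NonZero Λ}} → P * Λ + L ≡ K * Λ → L + suc r ≤ suc r * Λ →
                 Σ ℕ λ c → c ≤ r × L ≡ c * Λ × c + P ≡ K
leftover-units {P} {L} {K} {Λ} {r} total bound = K ∸ P , c≤r , L≡[K∸P]*Λ , ℕ.m∸n+n≡m P≤K
  where
  P≤K : P ≤ K
  P≤K = ℕ.*-cancelʳ-≤ P K Λ (ℕ.≤-trans (ℕ.m≤m+n (P * Λ) L) (ℕ.≤-reflexive total))
  L≡[K∸P]*Λ : L ≡ (K ∸ P) * Λ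
  L≡[K∸P]*Λ = begin
    L                  ≡⟨ ℕ.m+n∸m≡n (P * Λ) L ⟨
    P * Λ + L ∸ P * Λ  ≡⟨ cong (_∸ P * Λ) total ⟩
    K * Λ ∸ P * Λ      ≡⟨ ℕ.*-distribʳ-∸ Λ K P ⟨
    (K ∸ P) * Λ        ∎
    where open ≡-Reasoning
  c≤r : K ∸ P ≤ r
  c≤r = ℕ.≤-pred (ℕ.*-cancelʳ-< Λ (K ∸ P) (suc r)
          (subst (_< suc r * Λ) L≡[K∸P]*Λ (ℕ.<-≤-trans (ℕ.m<m+n L (s≤s z≤n)) bound)))

zero-sum-partition : ∀ {A : Set} (w : A → ℤ) e m Λ .{{_ : NonZero Λ}} → 1 ≤ m → m ≤ 2 + e →
                     (∀ ℓ → 1 ≤ ℓ → ℓ ≤ suc (e + m) → ℓ ∣ Λ) →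
                     ∀ k xs → All (Window m m ∘ w) xs → weight w xs ≡ 0ℤ → length xs ≡ k * ((e + m) * Λ) →
                     Σ (Fin k → List A) λ G → xs ↭ concat (tabulate G) ×
                                              (∀ j → ZeroSumOfLength w ((e + m) * Λ) (G j))
zero-sum-partition w e m Λ 1≤m m≤2+e divisors k xs bounded Σ≡0 |xs| =
  let r = e + m
      Bs , xs↭Bs , blocks = decompose-into-blocks w e m 1≤m m≤2+e xs bounded Σ≡0 (<-wellFounded _)
      Ps , Lo , Bs↭ , packs , Lo≡0 , |Lo|+D≤D*Λ = pack-blocks w (suc r) divisors Bs blocks
      total : length Ps * Λ + length Lo ≡ k * r * Λ
      total = begin
        length Ps * Λ + length Lo       ≡⟨ cong (_+ length Lo) (length-concat-uniform (All.map proj₂ packs)) ⟨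
        length (concat Ps) + length Lo  ≡⟨ List.length-++ (concat Ps) ⟨
        length (concat Ps ++ Lo)        ≡⟨ ↭-length (↭-trans xs↭Bs Bs↭) ⟨
        length xs                       ≡⟨ |xs| ⟩
        k * (r * Λ)                     ≡⟨ ℕ.*-assoc k r Λ ⟨
        k * r * Λ                       ∎
      c , c≤r , |Lo| , c+|Ps| = leftover-units {length Ps} {length Lo} {k * r} total |Lo|+D≤D*Λ
      G , Lo++Ps≡ , groups = assemble-groups w k c Lo Ps c≤r Lo≡0 |Lo| packs c+|Ps|
  in G , ↭-trans xs↭Bs (↭-trans Bs↭ (↭-trans (++-comm (concat Ps) Lo) (↭-reflexive Lo++Ps≡))) , groups
  where open ≡-Reasoning

∑-cong : ∀ n {g h : Fin n → ℕ} → (∀ i → g i ≡ h i) → ∑ n g ≡ ∑ n h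
∑-cong zero    _   = refl
∑-cong (suc n) g≗h = cong₂ _+_ (g≗h zero) (∑-cong n (g≗h ∘ suc))

∑-zero : ∀ n → ∑ n (λ _ → 0) ≡ 0
∑-zero zero    = refl
∑-zero (suc n) = ∑-zero n

∑-+ : ∀ n (g h : Fin n → ℕ) → ∑ n (λ i → g i + h i) ≡ ∑ n g + ∑ n h
∑-+ zero    g h = refl
∑-+ (suc n) g h = trans (cong (_+_ (g zero + h zero)) (∑-+ n (g ∘ suc) (h ∘ suc)))
                        (interchange (g zero) (h zero) (∑ n (g ∘ suc)) (∑ n (h ∘ suc)))
  where
  interchange : ∀ a b c d → a + b + (c + d) ≡ a + c + (b + d)
  interchange = ℕ-Ring.solve-∀

δ : ∀ {n} → Fin n → Fin n → ℕ
δ zero    zero    = 1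
δ zero    (suc _) = 0
δ (suc _) zero    = 0
δ (suc i) (suc j) = δ i j

δ-sym : ∀ {n} (i j : Fin n) → δ i j ≡ δ j i
δ-sym zero    zero    = refl
δ-sym zero    (suc _) = refl
δ-sym (suc _) zero    = refl
δ-sym (suc i) (suc j) = δ-sym i j

∑-*δ : ∀ n (g : Fin n → ℕ) a → ∑ n (λ i → g i * δ i a) ≡ g a
∑-*δ (suc n) g zero    = trans (cong₂ _+_ (ℕ.*-identityʳ (g zero))
                                         (trans (∑-cong n (λ i → ℕ.*-zeroʳ (g (suc i)))) (∑-zero n)))
                               (ℕ.+-identityʳ (g zero))
∑-*δ (suc n) g (suc a) = cong₂ _+_ (ℕ.*-zeroʳ (g zero)) (∑-*δ n (g ∘ suc) a)

multiplicity : ∀ {n} → Fin n → List (Fin n) → ℕ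
multiplicity i xs = sum (map (δ i) xs)

multiplicity-↭ : ∀ {n} (i : Fin n) {xs ys} → xs ↭ ys → multiplicity i xs ≡ multiplicity i ys
multiplicity-↭ i p = sum-↭ (map⁺ (δ i) p)

sum-map-concat-tabulate : ∀ {A : Set} (g : A → ℕ) k (G : Fin k → List A) →
                          sum (map g (concat (tabulate G))) ≡ ∑ k (λ j → sum (map g (G j)))
sum-map-concat-tabulate g zero    G = refl
sum-map-concat-tabulate g (suc k) G = begin
  sum (map g (G zero ++ concat (tabulate (G ∘ suc))))              ≡⟨ cong sum (List.map-++ g (G zero) _) ⟩
  sum (map g (G zero) ++ map g (concat (tabulate (G ∘ suc))))      ≡⟨ sum-++ (map g (G zero)) _ ⟩
  sum (map g (G zero)) + sum (map g (concat (tabulate (G ∘ suc)))) ≡⟨ cong (_+_ (sum (map g (G zero))))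
                                                                            (sum-map-concat-tabulate g k (G ∘ suc)) ⟩
  sum (map g (G zero)) + ∑ k (λ j → sum (map g (G (suc j))))       ∎
  where open ≡-Reasoning

sum-map-replicate : ∀ {A : Set} (g : A → ℕ) c a → sum (map g (replicate c a)) ≡ c * g a
sum-map-replicate g zero    a = refl
sum-map-replicate g (suc c) a = cong (_+_ (g a)) (sum-map-replicate g c a)

∑-*multiplicity : ∀ n (g : Fin n → ℕ) xs → ∑ n (λ i → g i * multiplicity i xs) ≡ sum (map g xs)
∑-*multiplicity n g []       = trans (∑-cong n (λ i → ℕ.*-zeroʳ (g i))) (∑-zero n)
∑-*multiplicity n g (a ∷ xs) = begin
  ∑ n (λ i → g i * (δ i a + multiplicity i xs))
    ≡⟨ ∑-cong n (λ i → ℕ.*-distribˡ-+ (g i) (δ i a) _) ⟩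
  ∑ n (λ i → g i * δ i a + g i * multiplicity i xs)
    ≡⟨ ∑-+ n _ _ ⟩
  ∑ n (λ i → g i * δ i a) + ∑ n (λ i → g i * multiplicity i xs)
    ≡⟨ cong₂ _+_ (∑-*δ n g a) (∑-*multiplicity n g xs) ⟩
  g a + sum (map g xs)
    ∎
  where open ≡-Reasoning

∑-multiplicity : ∀ n xs → ∑ n (λ i → multiplicity i xs) ≡ length xs
∑-multiplicity n []       = ∑-zero n
∑-multiplicity n (a ∷ xs) = trans (∑-+ n (λ i → δ i a) (λ i → multiplicity i xs))
  (cong₂ _+_ (trans (∑-cong n (λ i → sym (ℕ.*-identityˡ (δ i a)))) (∑-*δ n (λ _ → 1) a)) (∑-multiplicity n xs))

fromCounts : ∀ n → (Fin n → ℕ) → List (Fin n)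
fromCounts n x = concat (tabulate (λ j → replicate (x j) j))

multiplicity-fromCounts : ∀ n x (i : Fin n) → multiplicity i (fromCounts n x) ≡ x i
multiplicity-fromCounts n x i = begin
  multiplicity i (fromCounts n x)                  ≡⟨ sum-map-concat-tabulate (δ i) n _ ⟩
  ∑ n (λ j → sum (map (δ i) (replicate (x j) j)))  ≡⟨ ∑-cong n (λ j → sum-map-replicate (δ i) (x j) j) ⟩
  ∑ n (λ j → x j * δ i j)                          ≡⟨ ∑-cong n (λ j → cong (x j *_) (δ-sym i j)) ⟩
  ∑ n (λ j → x j * δ j i)                          ≡⟨ ∑-*δ n x i ⟩
  x i                                              ∎
  where open ≡-Reasoning

length-fromCounts : ∀ n x → length (fromCounts n x) ≡ ∑ n x
length-fromCounts n x = trans (sym (∑-multiplicity n (fromCounts n x))) (∑-cong n (multiplicity-fromCounts n x))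

sum-toℕ-fromCounts : ∀ n x → sum (map toℕ (fromCounts n x)) ≡ ∑ n (λ i → toℕ i * x i)
sum-toℕ-fromCounts n x = trans (sym (∑-*multiplicity n toℕ (fromCounts n x)))
                               (∑-cong n (λ i → cong (toℕ i *_) (multiplicity-fromCounts n x i)))

centred : ∀ {A : Set} → (A → ℕ) → ℕ → A → ℤ
centred g m a = + g a -ℤ + m

weight-centred : ∀ {A : Set} (g : A → ℕ) m xs → weight (centred g m) xs +ℤ + (m * length xs) ≡ + sum (map g xs)
weight-centred g m []       = trans (ℤ.+-identityˡ _) (cong +_ (ℕ.*-zeroʳ m))
weight-centred g m (a ∷ xs) = begin
  (+ g a -ℤ + m +ℤ W) +ℤ + (m * suc (length xs))     ≡⟨ cong (λ t → (+ g a -ℤ + m +ℤ W) +ℤ t)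
                                                             (trans (cong +_ (ℕ.*-suc m (length xs))) (ℤ.pos-+ m _)) ⟩
  (+ g a -ℤ + m +ℤ W) +ℤ (+ m +ℤ + (m * length xs))  ≡⟨ cancel (+ g a) (+ m) W (+ (m * length xs)) ⟩
  + g a +ℤ (W +ℤ + (m * length xs))                  ≡⟨ cong (+ g a +ℤ_) (weight-centred g m xs) ⟩
  + g a +ℤ + sum (map g xs)                          ≡⟨ ℤ.pos-+ (g a) _ ⟨
  + (g a + sum (map g xs))                           ∎
  where
  open ≡-Reasoning
  W = weight (centred g m) xs
  cancel : ∀ u v s t → (u -ℤ v +ℤ s) +ℤ (v +ℤ t) ≡ u +ℤ (s +ℤ t)
  cancel = solve-∀

weight-centred≡0⇒ : ∀ {A : Set} (g : A → ℕ) m xs → weight (centred g m) xs ≡ 0ℤ → sum (map g xs) ≡ m * length xs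
weight-centred≡0⇒ g m xs W≡0 =
  ℤ.+-injective (trans (sym (weight-centred g m xs)) (trans (cong (_+ℤ _) W≡0) (ℤ.+-identityˡ _)))

⇒weight-centred≡0 : ∀ {A : Set} (g : A → ℕ) m xs → sum (map g xs) ≡ m * length xs → weight (centred g m) xs ≡ 0ℤ
⇒weight-centred≡0 g m xs Σ≡ =
  ∙-cancelʳ (+ (m * length xs)) _ 0ℤ (trans (weight-centred g m xs) (trans (cong +_ Σ≡) (sym (ℤ.+-identityˡ _))))

window-centred : ∀ m (i : Fin (suc (2 * m))) → Window m m (centred toℕ m i)
window-centred m i =
  ℤ.≤-trans (ℤ.≤-reflexive (sym (ℤ.+-identityˡ (- (+ m))))) (ℤ.+-monoˡ-≤ (- (+ m)) (+≤+ z≤n)) ,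
  ℤ.≤-trans (ℤ.+-monoˡ-≤ (- (+ m)) (+≤+ (ℕ.≤-pred (Fin.toℕ<n i))))
            (ℤ.≤-reflexive (trans (cong (_-ℤ + m) (ℤ.pos-* 2 m)) (twice-minus-once (+ m))))
  where
  twice-minus-once : ∀ u → + 2 *ℤ u -ℤ u ≡ u
  twice-minus-once = solve-∀

Γ-divisible : ∀ ℓ d → 1 ≤ d → d ≤ ℓ → d ∣ Γ ℓ
Γ-divisible zero    d 1≤d d≤0 = ⊥-elim (ℕ.<⇒≱ 1≤d d≤0)
Γ-divisible (suc ℓ) d 1≤d d≤1+ℓ with d ℕ.≟ suc ℓ
... | yes refl     = m∣lcm[m,n] (suc ℓ) (Γ ℓ)
... | no d≢1+ℓ = ∣-trans (Γ-divisible ℓ d 1≤d (ℕ.≤-pred (ℕ.≤∧≢⇒< d≤1+ℓ d≢1+ℓ))) (n∣lcm[m,n] (suc ℓ) (Γ ℓ))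

-- suc (m ∸ 2 + m) is the block bound D = max(2, 2m − 1).
f≡ : ∀ m → 1 ≤ m → f m ≡ (m ∸ 2 + m) * Γ (suc (m ∸ 2 + m))
f≡ (suc zero)    _ = refl
f≡ (suc (suc k)) _ = cong (λ t → (k + suc (suc t)) * Γ (suc (k + suc (suc t)))) (ℕ.+-identityʳ k)

Splitting : (m : ℕ) → (Fin (suc (2 * m)) → ℕ) → ℕ → Set
Splitting m x K =
  Σ (Fin (suc (2 * m)) → Fin K → ℕ) λ y →
    ((j : Fin K) → (∑ (suc (2 * m)) (λ i → toℕ i * y i j) ≡ m * f m) × (∑ (suc (2 * m)) (λ i → y i j) ≡ f m))
    × ((i : Fin (suc (2 * m))) → ∑ K (λ j → y i j) ≡ x i)

splitting-from-partition : ∀ m x k (G : Fin k → List (Fin (suc (2 * m)))) →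
                           fromCounts (suc (2 * m)) x ↭ concat (tabulate G) →
                           (∀ j → ZeroSumOfLength (centred toℕ m) (f m) (G j)) → Splitting m x k
splitting-from-partition m x k G xs↭ groups = (λ i j → multiplicity i (G j)) , column , row
  where
  n = suc (2 * m)
  column : ∀ j → (∑ n (λ i → toℕ i * multiplicity i (G j)) ≡ m * f m) × (∑ n (λ i → multiplicity i (G j)) ≡ f m)
  column j =
    let G≡0 , |G| = groups j
    in trans (∑-*multiplicity n toℕ (G j)) (trans (weight-centred≡0⇒ toℕ m (G j) G≡0) (cong (m *_) |G|)) ,
       trans (∑-multiplicity n (G j)) |G|
  row : ∀ i → ∑ k (λ j → multiplicity i (G j)) ≡ x i
  row i = trans (sym (sum-map-concat-tabulate (δ i) k G))
                (trans (sym (multiplicity-↭ i xs↭)) (multiplicity-fromCounts n x i))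

counts-splitting : ∀ m → 1 ≤ m → ∀ x k → ∑ (suc (2 * m)) x ≡ k * f m →
                   ∑ (suc (2 * m)) (λ i → toℕ i * x i) ≡ m * ∑ (suc (2 * m)) x → Splitting m x k
counts-splitting m 1≤m x k Σx≡ Σix≡ =
  let G , xs↭ , groups = zero-sum-partition (centred toℕ m) e m Λ {{Λ≢0}} 1≤m (ℕ.m≤n+m∸n m 2)
                           (Γ-divisible (suc r)) k xs (All.universal (window-centred m) xs) xs≡0 |xs|
  in splitting-from-partition m x k G xs↭
       (λ j → subst (λ l → ZeroSumOfLength (centred toℕ m) l (G j)) (sym f≡r*Λ) (groups j))
  where
  n = suc (2 * m)
  e = m ∸ 2
  r = e + m
  Λ = Γ (suc r)
  xs = fromCounts n x
  f≡r*Λ : f m ≡ r * Λ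
  f≡r*Λ = f≡ m 1≤m
  Λ≢0 : NonZero Λ
  Λ≢0 = ℕ.m*n≢0⇒n≢0 r {{subst NonZero f≡r*Λ (f≢0 m 1≤m)}}
  |xs| : length xs ≡ k * (r * Λ)
  |xs| = trans (length-fromCounts n x) (trans Σx≡ (cong (k *_) f≡r*Λ))
  xs≡0 : weight (centred toℕ m) xs ≡ 0ℤ
  xs≡0 = ⇒weight-centred≡0 toℕ m xs
           (trans (sum-toℕ-fromCounts n x) (trans Σix≡ (cong (m *_) (sym (length-fromCounts n x)))))

lemma3p6 : (m : ℕ) → (m≥1 : m ≥ 1) → (β : ℤ) → (+ (f m)) ∣ℤ β →
  (x : Fin (suc (2 * m)) → ℕ) →
  + (∑ (suc (2 * m)) (λ i → toℕ i * x i)) ≡ + (2 * m) *ℤ β →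
  + (∑ (suc (2 * m)) x) ≡ + 2 *ℤ β →
  Σ (Fin (suc (2 * m)) → Fin ((∣ + 2 *ℤ β ∣ / f m) {{f≢0 m m≥1}}) → ℕ) λ y →
    ((j : Fin ((∣ + 2 *ℤ β ∣ / f m) {{f≢0 m m≥1}})) →
      (∑ (suc (2 * m)) (λ i → toℕ i * y i j) ≡ m * f m)
      × (∑ (suc (2 * m)) (λ i → y i j) ≡ f m))
    × ((i : Fin (suc (2 * m))) → ∑ ((∣ + 2 *ℤ β ∣ / f m) {{f≢0 m m≥1}}) (λ j → y i j) ≡ x i)
lemma3p6 m m≥1 β (divides q ∣β∣≡q*fm) x Σix≡2mβ Σx≡2β =
  subst (Splitting m x) (sym K≡2q) (counts-splitting m m≥1 x (2 * q) Σx≡ Σix≡)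
  where
  instance _ = f≢0 m m≥1
  ∣2β∣≡ : ∣ + 2 *ℤ β ∣ ≡ 2 * q * f m
  ∣2β∣≡ = trans (ℤ.abs-* (+ 2) β) (trans (cong (2 *_) ∣β∣≡q*fm) (sym (ℕ.*-assoc 2 q (f m))))
  K≡2q : ∣ + 2 *ℤ β ∣ / f m ≡ 2 * q
  K≡2q = trans (cong (_/ f m) ∣2β∣≡) (m*n/n≡m (2 * q) (f m))
  Σx≡ : ∑ (suc (2 * m)) x ≡ 2 * q * f m
  Σx≡ = trans (cong ∣_∣ Σx≡2β) ∣2β∣≡
  Σix≡ : ∑ (suc (2 * m)) (λ i → toℕ i * x i) ≡ m * ∑ (suc (2 * m)) x
  Σix≡ = ℤ.+-injective (begin
    + ∑ (suc (2 * m)) (λ i → toℕ i * x i)  ≡⟨ Σix≡2mβ ⟩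
    + (2 * m) *ℤ β                         ≡⟨ cong (_*ℤ β) (ℤ.pos-* 2 m) ⟩
    + 2 *ℤ + m *ℤ β                        ≡⟨ reassociate (+ 2) (+ m) β ⟩
    + m *ℤ (+ 2 *ℤ β)                      ≡⟨ cong (+ m *ℤ_) Σx≡2β ⟨
    + m *ℤ + ∑ (suc (2 * m)) x             ≡⟨ ℤ.pos-* m _ ⟨
    + (m * ∑ (suc (2 * m)) x)              ∎)
    where
    open ≡-Reasoning
    reassociate : ∀ u v b → u *ℤ v *ℤ b ≡ v *ℤ (u *ℤ b)
    reassociate = solve-∀
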